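{- Let $M$ be a hypermodular matroid of rank $4$. If $M$ contains a line and a plane (hyperplane) that are disjoint, then $M$ contains two disjoint coplanar lines. Moreover, if $\mathcal{M}$ is a modular cut of $M$ containing a disjoint line–plane pair, then $\mathcal{M}$ contains two disjoint coplanar lines.
   Context: Lines and planes are flats of rank $2$ and $3$; two lines are coplanar if their union has rank $3$. A pair of flats $(X,Y)$ is modular if $\operatorname{rk}(X)+\operatorname{rk}(Y)=\operatorname{rk}(X\cup Y)+\operatorname{rk}(X\cap Y)$; a matroid is hypermodular if every pair of hyperplanes is modular. A modular cut of $M$ is a set of flats closed under taking flat supersets and such that the intersection of any two members forming a modular pair is a member. -}

module Defs where

open import Data.Nat using (ℕ; _+_; _≤_; _<_)
open import Data.Fin using (Fin)
open import Data.Fin.Subset using (Subset; _∪_; _∩_; _⊆_; ∣_∣; ⁅_⁆; _∉_; ⊤; Empty)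
open import Data.Product using (_×_; ∃; ∃-syntax)
open import Relation.Binary.PropositionalEquality using (_≡_)

record Matroid (n : ℕ) : Set where
  field
    rk          : Subset n → ℕ
    rk-bounded  : ∀ X → rk X ≤ ∣ X ∣
    rk-mono     : ∀ {X Y} → X ⊆ Y → rk X ≤ rk Y
    rk-submod   : ∀ X Y → rk (X ∪ Y) + rk (X ∩ Y) ≤ rk X + rk Y

module _ {n : ℕ} (M : Matroid n) where
  open Matroid M

  rank : ℕ
  rank = rk ⊤

  IsFlat : Subset n → Set
  IsFlat X = ∀ e → e ∉ X → rk X < rk (X ∪ ⁅ e ⁆)

  IsLine : Subset n → Set
  IsLine X = IsFlat X × rk X ≡ 2

  IsPlane : Subset n → Set
  IsPlane X = IsFlat X × rk X ≡ 3

  IsHyperplane : Subset n → Set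
  IsHyperplane X = IsFlat X × rk X + 1 ≡ rank

  Coplanar : Subset n → Subset n → Set
  Coplanar X Y = rk (X ∪ Y) ≡ 3

  Disjoint : Subset n → Subset n → Set
  Disjoint X Y = Empty (X ∩ Y)

  ModularPair : Subset n → Subset n → Set
  ModularPair X Y = rk X + rk Y ≡ rk (X ∪ Y) + rk (X ∩ Y)

  Hypermodular : Set
  Hypermodular = ∀ X Y → IsHyperplane X → IsHyperplane Y → ModularPair X Y

  record IsModularCut (𝓜 : Subset n → Set) : Set where
    field
      members-flat : ∀ X → 𝓜 X → IsFlat X
      up-closed    : ∀ X Y → 𝓜 X → IsFlat Y → X ⊆ Y → 𝓜 Y
      modular-∩    : ∀ X Y → 𝓜 X → 𝓜 Y → ModularPair X Y → 𝓜 (X ∩ Y)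

  HasDisjointCoplanarLinesIn : (Subset n → Set) → Set
  HasDisjointCoplanarLinesIn 𝓜 =
    ∃[ L₁ ] ∃[ L₂ ] (𝓜 L₁ × 𝓜 L₂ × IsLine L₁ × IsLine L₂ × Disjoint L₁ L₂ × Coplanar L₁ L₂)

  HasDisjointLinePlaneIn : (Subset n → Set) → Set
  HasDisjointLinePlaneIn 𝓜 =
    ∃[ L ] ∃[ P ] (𝓜 L × 𝓜 P × IsLine L × IsPlane P × Disjoint L P)

-- Through the line L and a point e of P passes a plane Q, which is a hyperplane
-- distinct from P since it contains L ⊈ P.  Hypermodularity makes {Q, P} a
-- modular pair spanning M, so Q ∩ P is a line; it misses L because P does, and
-- L ∪ (Q ∩ P) lies in Q while containing L ∪ {e}, so it has rank 3.  If L and P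
-- belong to a modular cut, so do Q ⊇ L and then Q ∩ P.
module Submission where

open import Defs
open import Data.Nat using (ℕ; suc; _+_; _≤_; _<_; _≤?_; z<s)
open import Data.Nat.Properties
open import Data.Fin using (Fin)
open import Data.Fin.Subset using (Subset; _∪_; _∩_; _⊆_; ⁅_⁆; _∈_; _∉_; ⋃; ⊥; ∣_∣; Nonempty)
open import Data.Fin.Subset.Properties
  using (_∈?_; nonempty?; Empty-unique; ∣⊥∣≡0; ∣⁅x⁆∣≡1; x∈⁅x⁆; x∈⁅y⁆⇒x≡y; ⊆⊤; ⊆-trans;
         p⊆p∪q; q⊆p∪q; x∈p∪q⁻; p∩q⊆p; p∩q⊆q; x∈p∩q⁺; x∈p∩q⁻;
         ∪-assoc; ∪-comm; ∪-identityʳ)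
open import Data.List using (List; []; _∷_; map; filter; allFin)
open import Data.List.Relation.Unary.All using (All; []; _∷_)
open import Data.List.Relation.Unary.All.Properties using (all-filter)
open import Data.List.Relation.Unary.Any using (here; there)
open import Data.List.Membership.Propositional using () renaming (_∈_ to _∈ₗ_)
open import Data.List.Membership.Propositional.Properties using (∈-filter⁺; ∈-allFin)
open import Data.Product using (_×_; _,_; proj₁; proj₂)
open import Data.Sum using (inj₁; inj₂)
open import Data.Unit.Polymorphic using (⊤)
open import Relation.Nullary using (yes; no; contradiction)
open import Relation.Unary using (Decidable)
open import Relation.Binary.PropositionalEquality using (_≡_; refl; sym; trans; cong; subst)

module _ {n : ℕ} {A B C : Subset n} where

  ∪-⊆ : A ⊆ C → B ⊆ C → A ∪ B ⊆ C
  ∪-⊆ A⊆C B⊆C {x} x∈A∪B with x∈p∪q⁻ A B x∈A∪B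
  ... | inj₁ x∈A = A⊆C x∈A
  ... | inj₂ x∈B = B⊆C x∈B

  ⊆-∩ : A ⊆ B → A ⊆ C → A ⊆ B ∩ C
  ⊆-∩ A⊆B A⊆C x∈A = x∈p∩q⁺ (A⊆B x∈A , A⊆C x∈A)

∪-monoʳ-⊆ : ∀ {n} {A B : Subset n} (C : Subset n) → A ⊆ B → C ∪ A ⊆ C ∪ B
∪-monoʳ-⊆ C A⊆B = ∪-⊆ (p⊆p∪q _) (⊆-trans A⊆B (q⊆p∪q C _))

⁅⁆-⊆ : ∀ {n} {x : Fin n} {A : Subset n} → x ∈ A → ⁅ x ⁆ ⊆ A
⁅⁆-⊆ {x = x} x∈A y∈⁅x⁆ rewrite x∈⁅y⁆⇒x≡y x y∈⁅x⁆ = x∈A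

∈-⋃-⁅⁆ : ∀ {n} {y : Fin n} {ys : List (Fin n)} → y ∈ₗ ys → y ∈ ⋃ (map ⁅_⁆ ys)
∈-⋃-⁅⁆ {y = y} (here refl) = p⊆p∪q _ (x∈⁅x⁆ y)
∈-⋃-⁅⁆ {ys = z ∷ _} (there y∈ys) = q⊆p∪q ⁅ z ⁆ _ (∈-⋃-⁅⁆ y∈ys)

module _ {n : ℕ} (M : Matroid n) where
  open Matroid M
  open ≤-Reasoning

  rk≤rank : ∀ X → rk X ≤ rank M
  rk≤rank X = rk-mono ⊆⊤

  0<rk⇒Nonempty : ∀ X → 0 < rk X → Nonempty X
  0<rk⇒Nonempty X 0<rkX with nonempty? X
  ... | yes nonempty = nonempty
  ... | no empty rewrite Empty-unique empty =
    contradiction (≤-trans (rk-bounded ⊥) (≤-reflexive (∣⊥∣≡0 n))) (<⇒≱ 0<rkX)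

  rk-∪-⁅⁆-≤ : ∀ X e → rk (X ∪ ⁅ e ⁆) ≤ suc (rk X)
  rk-∪-⁅⁆-≤ X e = begin
    rk (X ∪ ⁅ e ⁆)                      ≤⟨ m≤m+n _ _ ⟩
    rk (X ∪ ⁅ e ⁆) + rk (X ∩ ⁅ e ⁆)     ≤⟨ rk-submod X ⁅ e ⁆ ⟩
    rk X + rk ⁅ e ⁆                     ≤⟨ +-monoʳ-≤ (rk X) (rk-bounded ⁅ e ⁆) ⟩
    rk X + ∣ ⁅ e ⁆ ∣                    ≡⟨ cong (rk X +_) (∣⁅x⁆∣≡1 e) ⟩
    rk X + 1                            ≡⟨ +-comm (rk X) 1 ⟩
    suc (rk X)                          ∎

  rk-flat-∪-⁅⁆ : ∀ {X e} → IsFlat M X → e ∉ X → rk (X ∪ ⁅ e ⁆) ≡ suc (rk X)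
  rk-flat-∪-⁅⁆ {X} {e} X-flat e∉X = ≤-antisym (rk-∪-⁅⁆-≤ X e) (X-flat e e∉X)

  rk-hyperplane-∪-⁅⁆ : ∀ {H e} → IsHyperplane M H → e ∉ H → rk (H ∪ ⁅ e ⁆) ≡ rank M
  rk-hyperplane-∪-⁅⁆ {H} (H-flat , rk-H) e∉H =
    trans (rk-flat-∪-⁅⁆ H-flat e∉H) (trans (+-comm 1 (rk H)) rk-H)

  Spans : Subset n → Fin n → Set
  Spans X e = rk (X ∪ ⁅ e ⁆) ≤ rk X

  spans? : ∀ X → Decidable (Spans X)
  spans? X e = rk (X ∪ ⁅ e ⁆) ≤? rk X

  spans-mono : ∀ {X Y e} → X ⊆ Y → Spans X e → Spans Y e
  spans-mono {X} {Y} {e} X⊆Y X-spans = +-cancelʳ-≤ (rk X) _ _ (begin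
    rk (Y ∪ ⁅ e ⁆) + rk X                              ≤⟨ +-mono-≤ (rk-mono Y∪e⊆) (rk-mono ⊆Y∩X∪e) ⟩
    rk (Y ∪ (X ∪ ⁅ e ⁆)) + rk (Y ∩ (X ∪ ⁅ e ⁆))        ≤⟨ rk-submod Y (X ∪ ⁅ e ⁆) ⟩
    rk Y + rk (X ∪ ⁅ e ⁆)                              ≤⟨ +-monoʳ-≤ (rk Y) X-spans ⟩
    rk Y + rk X                                        ∎)
    where
    Y∪e⊆ : Y ∪ ⁅ e ⁆ ⊆ Y ∪ (X ∪ ⁅ e ⁆)
    Y∪e⊆ = ∪-monoʳ-⊆ Y (q⊆p∪q X ⁅ e ⁆)
    ⊆Y∩X∪e : X ⊆ Y ∩ (X ∪ ⁅ e ⁆)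
    ⊆Y∩X∪e = ⊆-∩ X⊆Y (p⊆p∪q ⁅ e ⁆)

  rk-<-∪-outside-flat : ∀ {Z X e} → Z ⊆ X → IsFlat M X → e ∉ X → rk Z < rk (Z ∪ ⁅ e ⁆)
  rk-<-∪-outside-flat {e = e} Z⊆X X-flat e∉X =
    ≰⇒> (λ Z-spans → <⇒≱ (X-flat e e∉X) (spans-mono Z⊆X Z-spans))

  ∩-flat : ∀ {X Y} → IsFlat M X → IsFlat M Y → IsFlat M (X ∩ Y)
  ∩-flat {X} {Y} X-flat Y-flat e e∉X∩Y with e ∈? X
  ... | no e∉X = rk-<-∪-outside-flat (p∩q⊆p X Y) X-flat e∉X
  ... | yes e∈X = rk-<-∪-outside-flat (p∩q⊆q X Y) Y-flat (λ e∈Y → e∉X∩Y (x∈p∩q⁺ (e∈X , e∈Y)))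

  closure : Subset n → Subset n
  closure X = X ∪ ⋃ (map ⁅_⁆ (filter (spans? X) (allFin n)))

  X⊆closure : ∀ {X} → X ⊆ closure X
  X⊆closure = p⊆p∪q _

  rk-∪-spanned : ∀ X ys → All (Spans X) ys → rk (X ∪ ⋃ (map ⁅_⁆ ys)) ≤ rk X
  rk-∪-spanned X [] [] = ≤-reflexive (cong rk (∪-identityʳ X))
  rk-∪-spanned X (y ∷ ys) (X-spans-y ∷ X-spans-ys) = begin
    rk (X ∪ (⁅ y ⁆ ∪ S))  ≡⟨ cong rk (trans (cong (X ∪_) (∪-comm ⁅ y ⁆ S)) (sym (∪-assoc X S ⁅ y ⁆))) ⟩
    rk ((X ∪ S) ∪ ⁅ y ⁆)  ≤⟨ spans-mono (p⊆p∪q S) X-spans-y ⟩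
    rk (X ∪ S)            ≤⟨ rk-∪-spanned X ys X-spans-ys ⟩
    rk X                  ∎
    where
    S = ⋃ (map ⁅_⁆ ys)

  rk-closure : ∀ X → rk (closure X) ≡ rk X
  rk-closure X = ≤-antisym (rk-∪-spanned X _ (all-filter (spans? X) (allFin n))) (rk-mono X⊆closure)

  spans⇒∈closure : ∀ {X e} → Spans X e → e ∈ closure X
  spans⇒∈closure {X} {e} X-spans = q⊆p∪q X _ (∈-⋃-⁅⁆ (∈-filter⁺ (spans? X) (∈-allFin e) X-spans))

  closure-flat : ∀ X → IsFlat M (closure X)
  closure-flat X e e∉cl = ≰⇒> (λ cl-spans → e∉cl (spans⇒∈closure (begin
    rk (X ∪ ⁅ e ⁆)          ≤⟨ rk-mono (∪-⊆ (⊆-trans X⊆closure (p⊆p∪q _)) (q⊆p∪q _ _)) ⟩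
    rk (closure X ∪ ⁅ e ⁆)  ≤⟨ cl-spans ⟩
    rk (closure X)          ≡⟨ rk-closure X ⟩
    rk X                    ∎)))

  hyperplanes-∩-rk : Hypermodular M → ∀ {X Y} → IsHyperplane M X → IsHyperplane M Y →
                     rk (X ∪ Y) ≡ rank M → rk X ≡ suc (rk (X ∩ Y))
  hyperplanes-∩-rk hypermodular {X} {Y} X-hyp Y-hyp X∪Y-spanning = +-cancelˡ-≡ (rk Y) _ _ (begin-equality
    rk Y + rk X                ≡⟨ +-comm (rk Y) (rk X) ⟩
    rk X + rk Y                ≡⟨ hypermodular X Y X-hyp Y-hyp ⟩
    rk (X ∪ Y) + rk (X ∩ Y)    ≡⟨ cong (_+ rk (X ∩ Y)) (trans X∪Y-spanning (sym (proj₂ Y-hyp))) ⟩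
    rk Y + 1 + rk (X ∩ Y)      ≡⟨ +-assoc (rk Y) 1 (rk (X ∩ Y)) ⟩
    rk Y + suc (rk (X ∩ Y))    ∎)

  plane⇒hyperplane : rank M ≡ 4 → ∀ {X} → IsPlane M X → IsHyperplane M X
  plane⇒hyperplane rank≡4 (X-flat , rk-X) = X-flat , trans (cong (_+ 1) rk-X) (sym rank≡4)

module DisjointLinePlane {n : ℕ} (M : Matroid n) (rank≡4 : rank M ≡ 4) (hypermodular : Hypermodular M)
                         {L P : Subset n} (line : IsLine M L) (plane : IsPlane M P) (L∩P≡∅ : Disjoint M L P)
                         where
  open Matroid M
  open ≤-Reasoning

  L-flat : IsFlat M L
  L-flat = proj₁ line

  P-flat : IsFlat M P
  P-flat = proj₁ plane

  P-hyperplane : IsHyperplane M P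
  P-hyperplane = plane⇒hyperplane M rank≡4 plane

  P-nonempty : Nonempty P
  P-nonempty = 0<rk⇒Nonempty M P (subst (0 <_) (sym (proj₂ plane)) z<s)

  L-nonempty : Nonempty L
  L-nonempty = 0<rk⇒Nonempty M L (subst (0 <_) (sym (proj₂ line)) z<s)

  e : Fin n
  e = proj₁ P-nonempty

  e∈P : e ∈ P
  e∈P = proj₂ P-nonempty

  f : Fin n
  f = proj₁ L-nonempty

  f∈L : f ∈ L
  f∈L = proj₂ L-nonempty

  e∉L : e ∉ L
  e∉L e∈L = L∩P≡∅ (e , x∈p∩q⁺ (e∈L , e∈P))

  f∉P : f ∉ P
  f∉P f∈P = L∩P≡∅ (f , x∈p∩q⁺ (f∈L , f∈P))

  rk-L∪e : rk (L ∪ ⁅ e ⁆) ≡ 3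
  rk-L∪e = trans (rk-flat-∪-⁅⁆ M L-flat e∉L) (cong suc (proj₂ line))

  Q : Subset n
  Q = closure M (L ∪ ⁅ e ⁆)

  L∪e⊆Q : L ∪ ⁅ e ⁆ ⊆ Q
  L∪e⊆Q = X⊆closure M

  L⊆Q : L ⊆ Q
  L⊆Q = ⊆-trans (p⊆p∪q _) L∪e⊆Q

  Q-flat : IsFlat M Q
  Q-flat = closure-flat M _

  rk-Q : rk Q ≡ 3
  rk-Q = trans (rk-closure M _) rk-L∪e

  Q-hyperplane : IsHyperplane M Q
  Q-hyperplane = plane⇒hyperplane M rank≡4 (Q-flat , rk-Q)

  Q∪P-spanning : rk (Q ∪ P) ≡ rank M
  Q∪P-spanning = ≤-antisym (rk≤rank M _) (begin
    rank M               ≡⟨ rk-hyperplane-∪-⁅⁆ M P-hyperplane f∉P ⟨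
    rk (P ∪ ⁅ f ⁆)       ≤⟨ rk-mono (∪-⊆ (q⊆p∪q Q P) (⁅⁆-⊆ (p⊆p∪q P (L⊆Q f∈L)))) ⟩
    rk (Q ∪ P)           ∎)

  Q∩P-line : IsLine M (Q ∩ P)
  Q∩P-line = ∩-flat M Q-flat P-flat
           , suc-injective (trans (sym (hyperplanes-∩-rk M hypermodular Q-hyperplane P-hyperplane Q∪P-spanning)) rk-Q)

  L∩Q∩P≡∅ : Disjoint M L (Q ∩ P)
  L∩Q∩P≡∅ (x , x∈L∩Q∩P) with x∈p∩q⁻ L _ x∈L∩Q∩P
  ... | x∈L , x∈Q∩P = L∩P≡∅ (x , x∈p∩q⁺ (x∈L , p∩q⊆q Q P x∈Q∩P))

  L-coplanar-Q∩P : Coplanar M L (Q ∩ P)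
  L-coplanar-Q∩P = ≤-antisym
    (begin rk (L ∪ (Q ∩ P))   ≤⟨ rk-mono (∪-⊆ L⊆Q (p∩q⊆p Q P)) ⟩
           rk Q               ≡⟨ rk-Q ⟩
           3                  ∎)
    (begin 3                  ≡⟨ rk-L∪e ⟨
           rk (L ∪ ⁅ e ⁆)     ≤⟨ rk-mono (∪-monoʳ-⊆ L (⁅⁆-⊆ e∈Q∩P)) ⟩
           rk (L ∪ (Q ∩ P))   ∎)
    where
    e∈Q∩P : e ∈ Q ∩ P
    e∈Q∩P = x∈p∩q⁺ (L∪e⊆Q (q⊆p∪q L ⁅ e ⁆ (x∈⁅x⁆ e)) , e∈P)

proposition5 : ∀ {n : ℕ} (M : Matroid n) → rank M ≡ 4 → Hypermodular M
    → (HasDisjointLinePlaneIn M (λ _ → ⊤) → HasDisjointCoplanarLinesIn M (λ _ → ⊤))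
    × (∀ (𝓜 : Subset n → Set) → IsModularCut M 𝓜
        → HasDisjointLinePlaneIn M 𝓜 → HasDisjointCoplanarLinesIn M 𝓜)
proposition5 M rank≡4 hypermodular = lines , lines-in-cut
  where
  lines : HasDisjointLinePlaneIn M (λ _ → ⊤) → HasDisjointCoplanarLinesIn M (λ _ → ⊤)
  lines (L , P , _ , _ , line , plane , L∩P≡∅) =
    L , Q ∩ P , _ , _ , line , Q∩P-line , L∩Q∩P≡∅ , L-coplanar-Q∩P
    where open DisjointLinePlane M rank≡4 hypermodular line plane L∩P≡∅

  lines-in-cut : ∀ 𝓜 → IsModularCut M 𝓜 → HasDisjointLinePlaneIn M 𝓜 → HasDisjointCoplanarLinesIn M 𝓜
  lines-in-cut 𝓜 cut (L , P , L∈𝓜 , P∈𝓜 , line , plane , L∩P≡∅) =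
    L , Q ∩ P , L∈𝓜 , Q∩P∈𝓜 , line , Q∩P-line , L∩Q∩P≡∅ , L-coplanar-Q∩P
    where
    open DisjointLinePlane M rank≡4 hypermodular line plane L∩P≡∅
    open IsModularCut cut
    Q∈𝓜 : 𝓜 Q
    Q∈𝓜 = up-closed L Q L∈𝓜 Q-flat L⊆Q
    Q∩P∈𝓜 : 𝓜 (Q ∩ P)
    Q∩P∈𝓜 = modular-∩ Q P Q∈𝓜 P∈𝓜 (hypermodular Q P Q-hyperplane P-hyperplane)
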